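{- For every integer $n\ge 0$, there is a bijection between $\mathcal{P}_n$ and $\mathcal{R}_n$; in particular $|\mathcal{P}_n|=|\mathcal{R}_n|$.
   Context: A Deutsch path is a lattice path starting at the origin, consisting of upsteps $(1,1)$ and downsteps $(1,-j)$ with $j\ge 1$ an integer, that never goes below the $x$-axis; it is closed if it ends on the $x$-axis. $\mathcal{P}_n$ is the set of closed Deutsch paths with exactly $n$ steps that have short valley downsteps, meaning every downstep that is immediately followed by an upstep is the downstep $(1,-1)$. A Ramírez path is a lattice path starting at the origin, consisting of upsteps $(k,1)$ with $k\ge 1$ an integer and downsteps $(1,-1)$, that never goes below the $x$-axis and ends on the $x$-axis; its size is the $x$-coordinate of its terminal point. $\mathcal{R}_n$ is the set of Ramírez paths of size $n$. (For example, writing $U$ for $(1,1)$ and $j$ for $(1,-j)$, $\mathcal{P}_4=\{UUU3,UU11,U1U1\}$; writing $D$ for $(1,-1)$ and $k$ for $(k,1)$, $\mathcal{R}_4=\{1D1D,11DD,3D\}$.) -}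

module Defs where

open import Data.Nat using (ℕ; zero; suc; _+_; _∸_; _≤ᵇ_; _≡ᵇ_)
open import Data.Bool using (Bool; true; false; _∧_; if_then_else_; T)
open import Data.List using (List; []; _∷_; length)
open import Data.Product using (Σ; _×_)
open import Relation.Binary.PropositionalEquality using (_≡_)

-- Deutsch steps: U = (1,1);  dn j = (1, -(j+1)), so every downstep has size ≥ 1.
data DStep : Set where
  U  : DStep
  dn : ℕ → DStep

dsize : ℕ → ℕ
dsize j = suc j

closedFrom : ℕ → List DStep → Bool
closedFrom h []           = h ≡ᵇ 0
closedFrom h (U ∷ s)      = closedFrom (suc h) s
closedFrom h (dn j ∷ s)   = if dsize j ≤ᵇ h then closedFrom (h ∸ dsize j) s else false

shortValleys : List DStep → Bool
shortValleys []                     = true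
shortValleys (U ∷ s)                = shortValleys s
shortValleys (dn zero ∷ s)          = shortValleys s
shortValleys (dn (suc j) ∷ U ∷ s)   = false
shortValleys (dn (suc j) ∷ s)       = shortValleys s

𝒫 : ℕ → Set
𝒫 n = Σ (List DStep) λ p → (length p ≡ n) × T (closedFrom 0 p) × T (shortValleys p)

-- Ramírez steps: up k = (k+1, 1), so every upstep has width ≥ 1;  D = (1,-1).
data RStep : Set where
  up : ℕ → RStep
  D  : RStep

rClosedFrom : ℕ → List RStep → Bool
rClosedFrom h []            = h ≡ᵇ 0
rClosedFrom h (up k ∷ s)    = rClosedFrom (suc h) s
rClosedFrom zero (D ∷ s)    = false
rClosedFrom (suc h) (D ∷ s) = rClosedFrom h s

rSize : List RStep → ℕ
rSize []          = 0
rSize (up k ∷ s)  = suc k + rSize s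
rSize (D ∷ s)     = suc (rSize s)

ℛ : ℕ → Set
ℛ n = Σ (List RStep) λ r → (rSize r ≡ n) × T (rClosedFrom 0 r)

module Submission where

-- Both families are counted by the trees `node k c t`, read as the first-return
-- decomposition  (k+1,1) c (1,-1) t  of a Ramírez path. A tree also describes a
-- Deutsch path: for each node k′ c′ on the right spine of t, from the last to the
-- first, k′+1 upsteps, the path of c′ and a downstep (1,-1); then k+1 upsteps, the
-- path of c, and a downstep of size 1 + k + Σ k′ back to the starting height. Only
-- this final downstep can be long, so valleys are short, and the number of steps
-- equals the Ramírez size. Conversely, reading a short-valley Deutsch path from the
-- left, a downstep of size j+1 closes exactly the j+1 most recently opened levels,
-- so a stack of levels recovers the tree.

open import Defs
open import Data.Bool using (true; false; T)
open import Data.Bool.Properties using (T-irrelevant)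
open import Data.Empty using (⊥)
open import Data.List using (List; []; _∷_; _++_; length; take; drop)
open import Data.List.Properties using (∷-injective; take++drop≡id; length-take; length-drop; length-++)
open import Data.Maybe using (Maybe; just; nothing) renaming (map to mapMaybe)
open import Data.Maybe.Properties using (just-injective)
open import Data.Nat using (ℕ; zero; suc; _+_; _≤_; _≤ᵇ_; s≤s; s≤s⁻¹)
open import Data.Nat.Properties
  using (+-assoc; +-suc; +-identityʳ; m≤m+n; m+n∸m≡n; ≤⇒≤ᵇ; ≤ᵇ⇒≤; m≤n⇒m⊓n≡m; ≡-irrelevant)
open import Data.Nat.Tactic.RingSolver using (solve-∀)
open import Data.Product using (Σ; _×_; _,_; proj₁; proj₂; map₁; uncurry)
open import Data.Unit using (⊤; tt)
open import Data.Vec using (Vec; []; _∷_)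
open import Function.Bundles using (_⤖_; _↔_; mk↔ₛ′)
open import Function.Definitions using (Injective)
open import Function.Properties.Inverse using (↔-sym; ↔-trans; ↔⇒⤖)
open import Relation.Binary.PropositionalEquality
open import Relation.Nullary using (¬_)
open import Relation.Unary using (Irrelevant)

sized-↔ : {A B : Set} (encode : A → B) (sizeᴬ : A → ℕ) (sizeᴮ : B → ℕ) (Valid : B → Set) →
  Irrelevant Valid → Injective _≡_ _≡_ encode →
  (∀ a → sizeᴮ (encode a) ≡ sizeᴬ a) → (∀ a → Valid (encode a)) →
  (∀ {b} → Valid b → Σ A λ a → encode a ≡ b) →
  ∀ n → Σ A (λ a → sizeᴬ a ≡ n) ↔ Σ B (λ b → sizeᴮ b ≡ n × Valid b)
sized-↔ {A} {B} encode sizeᴬ sizeᴮ Valid irrelevant injective size-encode valid decode n =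
  mk↔ₛ′ to from to∘from from∘to
  where
  to : Σ A (λ a → sizeᴬ a ≡ n) → Σ B (λ b → sizeᴮ b ≡ n × Valid b)
  to (a , eq) = encode a , trans (size-encode a) eq , valid a

  from : Σ B (λ b → sizeᴮ b ≡ n × Valid b) → Σ A (λ a → sizeᴬ a ≡ n)
  from (b , eq , v) =
    proj₁ (decode v) , trans (sym (size-encode _)) (trans (cong sizeᴮ (proj₂ (decode v))) eq)

  to∘from : ∀ y → to (from y) ≡ y
  to∘from (b , eq , v) with decode v
  ... | a , refl = cong (encode a ,_) (cong₂ _,_ (≡-irrelevant _ _) (irrelevant _ _))

  from∘to : ∀ x → from (to x) ≡ x
  from∘to (a , eq) with decode (valid a)
  ... | a′ , encode-a′≡ with injective encode-a′≡
  ... | refl = cong (a ,_) (≡-irrelevant _ _)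

data Tree : Set where
  leaf : Tree
  node : ℕ → Tree → Tree → Tree

size : Tree → ℕ
size leaf         = 0
size (node k c t) = suc k + (size c + suc (size t))

-- Paths are built in continuation-passing style: `ramirez t r` is the path of t followed by r.
ramirez : Tree → List RStep → List RStep
ramirez leaf         r = r
ramirez (node k c t) r = up k ∷ ramirez c (D ∷ ramirez t r)

rSize-ramirez : ∀ t r → rSize (ramirez t r) ≡ size t + rSize r
rSize-ramirez leaf         r = refl
rSize-ramirez (node k c t) r = begin
  suc k + rSize (ramirez c (D ∷ ramirez t r))   ≡⟨ cong (suc k +_) (rSize-ramirez c _) ⟩
  suc k + (size c + suc (rSize (ramirez t r)))  ≡⟨ cong (λ m → suc k + (size c + suc m)) (rSize-ramirez t r) ⟩
  suc k + (size c + (suc (size t) + rSize r))   ≡⟨ cong (suc k +_) (sym (+-assoc (size c) _ _)) ⟩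
  suc k + (size c + suc (size t) + rSize r)     ≡⟨ sym (+-assoc (suc k) _ _) ⟩
  size (node k c t) + rSize r                   ∎
  where open ≡-Reasoning

rClosedFrom-ramirez : ∀ t h r → rClosedFrom h (ramirez t r) ≡ rClosedFrom h r
rClosedFrom-ramirez leaf         h r = refl
rClosedFrom-ramirez (node k c t) h r =
  trans (rClosedFrom-ramirez c (suc h) _) (rClosedFrom-ramirez t h r)

-- Continuations that cannot prolong an excursion; before them `ramirez` is prefix-free.
data Stop : List RStep → Set where
  stop-[] : Stop []
  stop-D  : ∀ {r} → Stop (D ∷ r)

ramirez-injective′ : ∀ {t t′ r r′} → Stop r → Stop r′ →
  ramirez t r ≡ ramirez t′ r′ → t ≡ t′ × r ≡ r′
ramirez-injective′ {leaf}       {leaf}          _       _       eq = refl , eq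
ramirez-injective′ {leaf}       {node _ _ _}    stop-[] _       ()
ramirez-injective′ {leaf}       {node _ _ _}    stop-D  _       ()
ramirez-injective′ {node _ _ _} {leaf}          _       stop-[] ()
ramirez-injective′ {node _ _ _} {leaf}          _       stop-D  ()
ramirez-injective′ {node k c t} {node k′ c′ t′} s       s′      eq with ∷-injective eq
... | refl , eq₁ with ramirez-injective′ {c} {c′} stop-D stop-D eq₁
... | refl , eq₂ with ramirez-injective′ {t} {t′} s s′ (proj₂ (∷-injective eq₂))
... | refl , refl = refl , refl

ramirez-injective : Injective _≡_ _≡_ (λ t → ramirez t [])
ramirez-injective eq = proj₁ (ramirez-injective′ stop-[] stop-[] eq)

joinD : ∀ {h} → Vec Tree (suc h) → List RStep
joinD {zero}  (t ∷ []) = ramirez t []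
joinD {suc h} (t ∷ ts) = ramirez t (D ∷ joinD ts)

graft : ∀ {h} → ℕ → Vec Tree (suc (suc h)) → Vec Tree (suc h)
graft k (c ∷ t ∷ ts) = node k c t ∷ ts

joinD-graft : ∀ {h} k (v : Vec Tree (suc (suc h))) → joinD (graft k v) ≡ up k ∷ joinD v
joinD-graft {zero}  k (c ∷ t ∷ []) = refl
joinD-graft {suc h} k (c ∷ t ∷ ts) = refl

-- A Ramírez path from height h splits at its first descents to h-1, …, 0 into h+1 Ramírez paths.
rparse : ∀ h r → T (rClosedFrom h r) → Vec Tree (suc h)
rparse h       (up k ∷ r) cl = graft k (rparse (suc h) r cl)
rparse zero    []         _  = leaf ∷ []
rparse (suc h) (D ∷ r)    cl = leaf ∷ rparse h r cl

joinD-rparse : ∀ h r cl → joinD (rparse h r cl) ≡ r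
joinD-rparse h       (up k ∷ r) cl =
  trans (joinD-graft k (rparse (suc h) r cl)) (cong (up k ∷_) (joinD-rparse (suc h) r cl))
joinD-rparse zero    []         _  = refl
joinD-rparse (suc h) (D ∷ r)    cl = cong (D ∷_) (joinD-rparse h r cl)

ramirez-surjective : ∀ {r} → T (rClosedFrom 0 r) → Σ Tree λ t → ramirez t [] ≡ r
ramirez-surjective {r} cl with rparse 0 r cl | joinD-rparse 0 r cl
... | t ∷ [] | eq = t , eq

ramirez-↔ : ∀ n → Σ Tree (λ t → size t ≡ n) ↔ ℛ n
ramirez-↔ = sized-↔ (λ t → ramirez t []) size rSize (λ r → T (rClosedFrom 0 r))
  T-irrelevant ramirez-injective
  (λ t → trans (rSize-ramirez t []) (+-identityʳ (size t)))
  (λ t → subst T (sym (rClosedFrom-ramirez t 0 [])) tt)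
  ramirez-surjective

ups : ℕ → List DStep → List DStep
ups zero    q = q
ups (suc n) q = U ∷ ups n q

ups-U : ∀ n q → ups n (U ∷ q) ≡ U ∷ ups n q
ups-U zero    q = refl
ups-U (suc n) q = cong (U ∷_) (ups-U n q)

climb : Tree → ℕ
climb leaf         = 0
climb (node k _ t) = k + climb t

mutual
  deutsch : Tree → List DStep → List DStep
  deutsch leaf         q = q
  deutsch (node k c t) q = arc k c t (dn (k + climb t) ∷ q)

  flat : Tree → List DStep → List DStep
  flat leaf         q = q
  flat (node k c t) q = arc k c t (dn 0 ∷ q)

  arc : ℕ → Tree → Tree → List DStep → List DStep
  arc k c t q = flat t (ups (suc k) (deutsch c q))

deutsch-flat : ∀ t q → climb t ≡ 0 → deutsch t q ≡ flat t q
deutsch-flat leaf         q _  = refl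
deutsch-flat (node k c t) q eq = cong (λ j → arc k c t (dn j ∷ q)) eq

closedFrom-ups : ∀ n h q → closedFrom h (ups n q) ≡ closedFrom (n + h) q
closedFrom-ups zero    h q = refl
closedFrom-ups (suc n) h q = trans (closedFrom-ups n (suc h) q) (cong (λ m → closedFrom m q) (+-suc n h))

closedFrom-dn : ∀ j h q → closedFrom (suc j + h) (dn j ∷ q) ≡ closedFrom h q
closedFrom-dn j h q with dsize j ≤ᵇ suc j + h | ≤⇒≤ᵇ (m≤m+n (suc j) h)
... | true | _ = cong (λ m → closedFrom m q) (m+n∸m≡n (suc j) h)

mutual
  closedFrom-arc : ∀ k c t h q → closedFrom h (arc k c t q) ≡ closedFrom (suc (k + climb t + h)) q
  closedFrom-arc k c t h q = begin
    closedFrom h (flat t (ups (suc k) (deutsch c q)))     ≡⟨ closedFrom-flat t h _ ⟩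
    closedFrom (climb t + h) (ups (suc k) (deutsch c q))  ≡⟨ closedFrom-ups (suc k) _ _ ⟩
    closedFrom (suc k + (climb t + h)) (deutsch c q)      ≡⟨ closedFrom-deutsch c _ q ⟩
    closedFrom (suc k + (climb t + h)) q                  ≡⟨ cong (λ m → closedFrom (suc m) q) (sym (+-assoc k _ h)) ⟩
    closedFrom (suc (k + climb t + h)) q                  ∎
    where open ≡-Reasoning

  closedFrom-deutsch : ∀ t h q → closedFrom h (deutsch t q) ≡ closedFrom h q
  closedFrom-deutsch leaf         h q = refl
  closedFrom-deutsch (node k c t) h q =
    trans (closedFrom-arc k c t h _) (closedFrom-dn (k + climb t) h q)

  closedFrom-flat : ∀ t h q → closedFrom h (flat t q) ≡ closedFrom (climb t + h) q
  closedFrom-flat leaf         h q = refl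
  closedFrom-flat (node k c t) h q =
    trans (closedFrom-arc k c t h _) (closedFrom-dn 0 (k + climb t + h) q)

length-ups : ∀ n q → length (ups n q) ≡ n + length q
length-ups zero    q = refl
length-ups (suc n) q = cong suc (length-ups n q)

mutual
  length-arc : ∀ k c t x q → length (arc k c t (x ∷ q)) ≡ size (node k c t) + length q
  length-arc k c t x q = begin
    length (flat t (ups (suc k) (deutsch c (x ∷ q))))  ≡⟨ length-flat t _ ⟩
    size t + length (ups (suc k) (deutsch c (x ∷ q)))  ≡⟨ cong (size t +_) (length-ups (suc k) _) ⟩
    size t + (suc k + length (deutsch c (x ∷ q)))      ≡⟨ cong (λ m → size t + (suc k + m)) (length-deutsch c _) ⟩
    size t + (suc k + (size c + suc (length q)))       ≡⟨ rearrange (size t) k (size c) (length q) ⟩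
    size (node k c t) + length q                       ∎
    where
    open ≡-Reasoning
    rearrange : ∀ a k b l → a + (suc k + (b + suc l)) ≡ suc k + (b + suc a) + l
    rearrange = solve-∀

  length-deutsch : ∀ t q → length (deutsch t q) ≡ size t + length q
  length-deutsch leaf         q = refl
  length-deutsch (node k c t) q = length-arc k c t _ q

  length-flat : ∀ t q → length (flat t q) ≡ size t + length q
  length-flat leaf         q = refl
  length-flat (node k c t) q = length-arc k c t _ q

StartsWithU : List DStep → Set
StartsWithU (U ∷ _) = ⊤
StartsWithU _       = ⊥

shortValleys-ups : ∀ n {q} → T (shortValleys q) → T (shortValleys (ups n q))
shortValleys-ups zero    sv = sv
shortValleys-ups (suc n) sv = shortValleys-ups n sv

shortValleys-dn : ∀ j q → T (shortValleys q) → ¬ StartsWithU q → T (shortValleys (dn j ∷ q))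
shortValleys-dn zero    q          sv _  = sv
shortValleys-dn (suc j) []         sv _  = sv
shortValleys-dn (suc j) (U ∷ q)    _  ¬U with () ← ¬U tt
shortValleys-dn (suc j) (dn _ ∷ q) sv _  = sv

shortValleys-tail : ∀ j p → T (shortValleys (dn j ∷ p)) → T (shortValleys p)
shortValleys-tail zero    p          sv = sv
shortValleys-tail (suc j) []         sv = sv
shortValleys-tail (suc j) (dn _ ∷ p) sv = sv

mutual
  shortValleys-arc : ∀ k c t q → T (shortValleys q) → ¬ StartsWithU q → T (shortValleys (arc k c t q))
  shortValleys-arc k c t q sv ¬U =
    shortValleys-flat t _ (shortValleys-ups (suc k) (shortValleys-deutsch c q sv ¬U))

  shortValleys-deutsch : ∀ t q → T (shortValleys q) → ¬ StartsWithU q → T (shortValleys (deutsch t q))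
  shortValleys-deutsch leaf         q sv _  = sv
  shortValleys-deutsch (node k c t) q sv ¬U =
    shortValleys-arc k c t _ (shortValleys-dn (k + climb t) q sv ¬U) λ ()

  shortValleys-flat : ∀ t q → T (shortValleys q) → T (shortValleys (flat t q))
  shortValleys-flat leaf         q sv = sv
  shortValleys-flat (node k c t) q sv = shortValleys-arc k c t _ sv λ ()

comb : List Tree → Tree
comb []       = leaf
comb (c ∷ cs) = node 0 c (comb cs)

climb-comb : ∀ cs → climb (comb cs) ≡ 0
climb-comb []       = refl
climb-comb (c ∷ cs) = climb-comb cs

asComb : Tree → Maybe (List Tree)
asComb leaf               = just []
asComb (node zero c t)    = mapMaybe (c ∷_) (asComb t)
asComb (node (suc _) _ _) = nothing

asComb-comb : ∀ cs → asComb (comb cs) ≡ just cs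
asComb-comb []       = refl
asComb-comb (c ∷ cs) = cong (mapMaybe (c ∷_)) (asComb-comb cs)

comb-asComb : ∀ t {cs} → asComb t ≡ just cs → comb cs ≡ t
comb-asComb leaf            refl = refl
comb-asComb (node zero c t) eq with asComb t in e
comb-asComb (node zero c t) refl | just cs = cong (node 0 c) (comb-asComb t e)

spine : List Tree → List (List Tree) → ℕ × Tree
spine []      []       = 0 , leaf
spine []      (E ∷ Es) = map₁ suc (spine E Es)
spine (c ∷ E) Es       = 0 , node (proj₁ (spine E Es)) c (proj₂ (spine E Es))

unspine : ℕ → Tree → List Tree × List (List Tree)
unspine zero    leaf         = [] , []
unspine (suc k) t            = [] , uncurry _∷_ (unspine k t)
unspine zero    (node k c t) = map₁ (c ∷_) (unspine k t)

spine-unspine : ∀ k t → uncurry spine (unspine k t) ≡ (k , t)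
spine-unspine zero    leaf         = refl
spine-unspine (suc k) t            = cong (map₁ suc) (spine-unspine k t)
spine-unspine zero    (node k c t) = cong (λ s → 0 , node (proj₁ s) c (proj₂ s)) (spine-unspine k t)

spine-[] : ∀ E → spine E [] ≡ (0 , comb E)
spine-[] []      = refl
spine-[] (c ∷ E) = cong (λ s → 0 , node (proj₁ s) c (proj₂ s)) (spine-[] E)

climb-spine : ∀ E Es → proj₁ (spine E Es) + climb (proj₂ (spine E Es)) ≡ length Es
climb-spine []      []       = refl
climb-spine []      (E ∷ Es) = cong suc (climb-spine E Es)
climb-spine (c ∷ E) Es       = climb-spine E Es

-- The tree completed by a downstep of size (length Es)+1 that closes the levels E ∷ Es above `top`.
close : List Tree → List (List Tree) → Tree → Tree
close E Es top = node (proj₁ (spine E Es)) top (proj₂ (spine E Es))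

asComb-close : ∀ E c → asComb (close E [] c) ≡ just (c ∷ E)
asComb-close E c =
  trans (cong (λ s → asComb (node (proj₁ s) c (proj₂ s))) (spine-[] E)) (asComb-comb (c ∷ E))

stackWord : List (List Tree) → List DStep → List DStep
stackWord []       q = q
stackWord (E ∷ Es) q = stackWord Es (flat (comb E) (U ∷ q))

stackWord-++ : ∀ Es Fs q → stackWord (Es ++ Fs) q ≡ stackWord Fs (stackWord Es q)
stackWord-++ []       Fs q = refl
stackWord-++ (E ∷ Es) Fs q = stackWord-++ Es Fs _

stackWord-spine : ∀ E Es q →
  stackWord (E ∷ Es) q ≡ flat (proj₂ (spine E Es)) (ups (suc (proj₁ (spine E Es))) q)
stackWord-spine []      []       q = refl
stackWord-spine []      (E ∷ Es) q = trans (stackWord-spine E Es (U ∷ q))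
  (cong (flat (proj₂ (spine E Es))) (ups-U (suc (proj₁ (spine E Es))) q))
stackWord-spine (c ∷ E) Es       q = stackWord-spine E Es _

stackWord-close : ∀ E Es top q →
  stackWord (E ∷ Es) (deutsch top (dn (length Es) ∷ q)) ≡ deutsch (close E Es top) q
stackWord-close E Es top q = trans (stackWord-spine E Es _)
  (cong (λ j → arc (proj₁ (spine E Es)) top (proj₂ (spine E Es)) (dn j ∷ q)) (sym (climb-spine E Es)))

-- `run stack top p` reads p from height `length stack`. The stack holds, for each open level
-- below the current one, the excursions completed on it, most recent first; `top` is the
-- tree read so far on the current level.
run : List (List Tree) → Tree → List DStep → Maybe Tree
run stack top (U ∷ p) with asComb top
... | just E  = run (E ∷ stack) leaf p
... | nothing = nothing
run []          top []         = just top
run (_ ∷ _)     _   []         = nothing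
run []          _   (dn j ∷ p) = nothing
run (E ∷ stack) top (dn j ∷ p) with dsize j ≤ᵇ length (E ∷ stack)
... | true  = run (drop j stack) (close E (take j stack) top) p
... | false = nothing

run-push : ∀ stack top {E} p → asComb top ≡ just E → run stack top (U ∷ p) ≡ run (E ∷ stack) leaf p
run-push stack top p eq rewrite eq = refl

take-length-++ : ∀ {A : Set} (xs ys : List A) → take (length xs) (xs ++ ys) ≡ xs
take-length-++ []       ys = refl
take-length-++ (x ∷ xs) ys = cong (x ∷_) (take-length-++ xs ys)

drop-length-++ : ∀ {A : Set} (xs ys : List A) → drop (length xs) (xs ++ ys) ≡ ys
drop-length-++ []       ys = refl
drop-length-++ (x ∷ xs) ys = drop-length-++ xs ys

length≤length-++ : ∀ {A : Set} (xs ys : List A) → length xs ≤ length (xs ++ ys)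
length≤length-++ xs ys = subst (length xs ≤_) (sym (length-++ xs)) (m≤m+n (length xs) (length ys))

run-pop : ∀ E Es stack top p →
  run (E ∷ Es ++ stack) top (dn (length Es) ∷ p) ≡ run stack (close E Es top) p
run-pop E Es stack top p
  with dsize (length Es) ≤ᵇ length (E ∷ Es ++ stack) | ≤⇒≤ᵇ (s≤s (length≤length-++ Es stack))
... | true | _ rewrite take-length-++ Es stack | drop-length-++ Es stack = refl

mutual
  run-deutsch : ∀ t stack p → run stack leaf (deutsch t p) ≡ run stack t p
  run-deutsch leaf         stack p = refl
  run-deutsch (node k c t) stack p = begin
    run stack leaf (flat t (ups (suc k) (deutsch c (dn (k + climb t) ∷ p))))
      ≡⟨ run-flat k t stack _ ⟩
    run (E ∷ Es ++ stack) leaf (deutsch c (dn (k + climb t) ∷ p))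
      ≡⟨ run-deutsch c _ _ ⟩
    run (E ∷ Es ++ stack) c (dn (k + climb t) ∷ p)
      ≡⟨ cong (λ j → run (E ∷ Es ++ stack) c (dn j ∷ p)) (sym length-Es) ⟩
    run (E ∷ Es ++ stack) c (dn (length Es) ∷ p)
      ≡⟨ run-pop E Es stack c p ⟩
    run stack (close E Es c) p
      ≡⟨ cong (λ s → run stack (node (proj₁ s) c (proj₂ s)) p) (spine-unspine k t) ⟩
    run stack (node k c t) p
      ∎
    where
    open ≡-Reasoning
    E = proj₁ (unspine k t)
    Es = proj₂ (unspine k t)
    length-Es : length Es ≡ k + climb t
    length-Es =
      trans (sym (climb-spine E Es)) (cong (λ s → proj₁ s + climb (proj₂ s)) (spine-unspine k t))

  run-flat : ∀ k t stack p →
    run stack leaf (flat t (ups (suc k) p)) ≡ run (uncurry _∷_ (unspine k t) ++ stack) leaf p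
  run-flat zero    leaf         stack p = refl
  run-flat (suc k) t            stack p =
    trans (cong (λ q → run stack leaf (flat t q)) (sym (ups-U (suc k) p))) (run-flat k t stack (U ∷ p))
  run-flat zero    (node k c t) stack p = begin
    run stack leaf (flat t (ups (suc k) (deutsch c (dn 0 ∷ U ∷ p))))
      ≡⟨ run-flat k t stack _ ⟩
    run (E ∷ Es ++ stack) leaf (deutsch c (dn 0 ∷ U ∷ p))
      ≡⟨ run-deutsch c _ _ ⟩
    run (E ∷ Es ++ stack) c (dn 0 ∷ U ∷ p)
      ≡⟨ run-pop E [] (Es ++ stack) c (U ∷ p) ⟩
    run (Es ++ stack) (close E [] c) (U ∷ p)
      ≡⟨ run-push (Es ++ stack) (close E [] c) p (asComb-close E c) ⟩
    run ((c ∷ E) ∷ Es ++ stack) leaf p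
      ∎
    where
    open ≡-Reasoning
    E = proj₁ (unspine k t)
    Es = proj₂ (unspine k t)

fits⇒≤ : ∀ j n → (dsize j ≤ᵇ suc n) ≡ true → j ≤ n
fits⇒≤ j n eq = s≤s⁻¹ (≤ᵇ⇒≤ (dsize j) (suc n) (subst T (sym eq) tt))

run-sound : ∀ stack top p {t} → run stack top p ≡ just t → stackWord stack (deutsch top p) ≡ deutsch t []
run-sound stack top (U ∷ p) {t} eq with asComb top in e
... | just E = begin
  stackWord stack (deutsch top (U ∷ p))
    ≡⟨ cong (λ s → stackWord stack (deutsch s (U ∷ p))) (sym (comb-asComb top e)) ⟩
  stackWord stack (deutsch (comb E) (U ∷ p))
    ≡⟨ cong (stackWord stack) (deutsch-flat (comb E) _ (climb-comb E)) ⟩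
  stackWord (E ∷ stack) p
    ≡⟨ run-sound (E ∷ stack) leaf p eq ⟩
  deutsch t []
    ∎
  where open ≡-Reasoning
run-sound []          top []         refl = refl
run-sound (E ∷ stack) top (dn j ∷ p) {t} eq with dsize j ≤ᵇ length (E ∷ stack) in fits
... | true = begin
  stackWord (E ∷ stack) (deutsch top (dn j ∷ p))
    ≡⟨ cong₂ (λ s i → stackWord (E ∷ s) (deutsch top (dn i ∷ p)))
             (sym (take++drop≡id j stack)) (sym length-Es) ⟩
  stackWord (E ∷ Es ++ rest) (deutsch top (dn (length Es) ∷ p))
    ≡⟨ stackWord-++ (E ∷ Es) rest _ ⟩
  stackWord rest (stackWord (E ∷ Es) (deutsch top (dn (length Es) ∷ p)))
    ≡⟨ cong (stackWord rest) (stackWord-close E Es top p) ⟩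
  stackWord rest (deutsch (close E Es top) p)
    ≡⟨ run-sound rest (close E Es top) p eq ⟩
  deutsch t []
    ∎
  where
  open ≡-Reasoning
  Es = take j stack
  rest = drop j stack
  length-Es : length Es ≡ j
  length-Es = trans (length-take j stack) (m≤n⇒m⊓n≡m (fits⇒≤ j (length stack) fits))

Pushable : Tree → Set
Pushable top = Σ (List Tree) λ E → asComb top ≡ just E

pushable-after-dn : ∀ j q E stack top → T (shortValleys (dn j ∷ q)) → StartsWithU q →
  Pushable (close E (take j stack) top)
pushable-after-dn zero (U ∷ q) E stack top _ _ = top ∷ E , asComb-close E top

run-complete : ∀ stack top p → T (closedFrom (length stack) p) → T (shortValleys p) →
  (StartsWithU p → Pushable top) → Σ Tree λ t → run stack top p ≡ just t
run-complete stack top (U ∷ p) cl sv pushable with pushable tt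
... | E , e rewrite e = run-complete (E ∷ stack) leaf p cl sv λ _ → [] , refl
run-complete []          top []         _  _  _ = top , refl
run-complete (E ∷ stack) top (dn j ∷ p) cl sv _ with dsize j ≤ᵇ length (E ∷ stack)
... | true = run-complete (drop j stack) (close E (take j stack) top) p
  (subst (λ h → T (closedFrom h p)) (sym (length-drop j stack)) cl)
  (shortValleys-tail j p sv) (pushable-after-dn j p E stack top sv)

deutsch-injective : Injective _≡_ _≡_ (λ t → deutsch t [])
deutsch-injective {t} {t′} eq = just-injective (begin
  just t                      ≡⟨ sym (run-deutsch t [] []) ⟩
  run [] leaf (deutsch t [])  ≡⟨ cong (run [] leaf) eq ⟩
  run [] leaf (deutsch t′ []) ≡⟨ run-deutsch t′ [] [] ⟩
  just t′                     ∎)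
  where open ≡-Reasoning

deutsch-surjective : ∀ {p} → T (closedFrom 0 p) × T (shortValleys p) → Σ Tree λ t → deutsch t [] ≡ p
deutsch-surjective {p} (cl , sv) with run-complete [] leaf p cl sv (λ _ → [] , refl)
... | t , eq = t , sym (run-sound [] leaf p eq)

deutsch-↔ : ∀ n → Σ Tree (λ t → size t ≡ n) ↔ 𝒫 n
deutsch-↔ = sized-↔ (λ t → deutsch t []) size length (λ p → T (closedFrom 0 p) × T (shortValleys p))
  (λ (a , b) (a′ , b′) → cong₂ _,_ (T-irrelevant a a′) (T-irrelevant b b′))
  deutsch-injective
  (λ t → trans (length-deutsch t []) (+-identityʳ (size t)))
  (λ t → subst T (sym (closedFrom-deutsch t 0 [])) tt , shortValleys-deutsch t [] tt λ ())
  deutsch-surjective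

mainTheorem3 : (n : ℕ) → 𝒫 n ⤖ ℛ n
mainTheorem3 n = ↔⇒⤖ (↔-trans (↔-sym (deutsch-↔ n)) (ramirez-↔ n))
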